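{- Let $S$ and $T$ be balanced bitstrings. Then there exists an integer $n\ge0$ such that $w^n(S)$ and $w^n(T)$ differ by defects.
   Context: Two bitstrings are balanced if they have the same length and the same number of ones. $w$ is the map on bitstrings that simultaneously replaces each $0$ by $001$ and each $1$ by $01$; $w^n$ is its $n$-fold iterate. Characters are indexed from $1$, $S[i]$ denoting the $i$-th character. For balanced $S,T$ of length $L$, a defect is an index $1\le i\le L-1$ such that the length-$(i-1)$ prefixes of $S$ and $T$ are balanced, $S[i]\neq T[i]$, $S[i]\neq S[i+1]$, and $S[i+1]\neq T[i+1]$. $S$ and $T$ differ by defects if they are balanced and for every index $1\le i\le L$ with $S[i]\neq T[i]$ there is a defect at index $i-1$ or at index $i$. -}

module Defs where

open import Data.Bool using (Bool; true; false)
open import Data.Nat using (ℕ; zero; suc; _≤_; _<_)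
open import Data.List using (List; []; _∷_; length; take; concatMap; filter)
open import Data.Product using (_×_)
open import Data.Sum using (_⊎_)
open import Relation.Binary.PropositionalEquality using (_≡_; _≢_)
open import Function using (id)

-- Bitstrings: lists of bits, false = 0, true = 1.
Bitstring : Set
Bitstring = List Bool

ones : Bitstring → ℕ
ones [] = 0
ones (true ∷ s) = suc (ones s)
ones (false ∷ s) = ones s

Balanced : Bitstring → Bitstring → Set
Balanced S T = (length S ≡ length T) × (ones S ≡ ones T)

wLetter : Bool → Bitstring
wLetter false = false ∷ false ∷ true ∷ []
wLetter true = false ∷ true ∷ []

w : Bitstring → Bitstring
w = concatMap wLetter

wⁿ : ℕ → Bitstring → Bitstring
wⁿ zero S = S
wⁿ (suc n) S = w (wⁿ n S)

-- 1-indexed character access: at S i = S[i] for 1 ≤ i ≤ length S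
-- (the value outside that range is irrelevant; it is only used in range).
at : Bitstring → ℕ → Bool
at [] _ = false
at (b ∷ s) zero = false
at (b ∷ s) (suc zero) = b
at (b ∷ s) (suc (suc i)) = at s (suc i)

Defect : Bitstring → Bitstring → ℕ → Set
Defect S T i =
  (1 ≤ i) × (suc i ≤ length S) ×
  Balanced (take (i Data.Nat.∸ 1) S) (take (i Data.Nat.∸ 1) T) ×
  (at S i ≢ at T i) × (at S i ≢ at S (suc i)) × (at S (suc i) ≢ at T (suc i))

DifferByDefects : Bitstring → Bitstring → Set
DifferByDefects S T =
  Balanced S T ×
  ((i : ℕ) → 1 ≤ i → i ≤ length S → at S i ≢ at T i →
     Defect S T (i Data.Nat.∸ 1) ⊎ Defect S T i)

-- Call m a lead bound for S over T if every prefix of S has at most m more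
-- ones than the prefix of T of the same length.  Since every image w b ends in
-- its only 1, a lead bound of m ≤ 2k for S over T yields a lead bound of k for
-- w S over w T: if the q-prefix of w S contained too many more ones, it would
-- contain the images of more letters than the q-prefix of w T, and each extra
-- letter costs at least two characters, more than the difference in length of
-- the images of equally long prefixes of S and T can pay for.  Iterating, the
-- lead bound drops to 1 in both directions, and then w S and w T differ by
-- swaps of disjoint adjacent pairs 10 ↔ 01, each of which is a defect.

module Submission where

open import Defs
open import Data.Bool using (true; false)
open import Data.Empty using (⊥-elim)
open import Data.List using ([]; _∷_; length; take; _++_)
open import Data.List.Properties using (length-take)
open import Data.Nat using (ℕ; zero; suc; _+_; _*_; _∸_; _≤_; _<_; _≮_; z≤n; s≤s; s≤s⁻¹)
open import Data.Nat.Properties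
open import Data.Product using (∃; _,_)
open import Data.Sum as Sum using (_⊎_; inj₁; inj₂)
open import Relation.Binary.PropositionalEquality

Balanced-∷ : ∀ b {s t} → Balanced s t → Balanced (b ∷ s) (b ∷ t)
Balanced-∷ true  (l , o) = cong suc l , cong suc o
Balanced-∷ false (l , o) = cong suc l , o

Balanced-∷⁻¹ : ∀ b {s t} → Balanced (b ∷ s) (b ∷ t) → Balanced s t
Balanced-∷⁻¹ true  (l , o) = suc-injective l , suc-injective o
Balanced-∷⁻¹ false (l , o) = suc-injective l , o

ones-swap : ∀ a b s → ones (a ∷ b ∷ s) ≡ ones (b ∷ a ∷ s)
ones-swap true  true  s = refl
ones-swap true  false s = refl
ones-swap false true  s = refl
ones-swap false false s = refl

Balanced-swap : ∀ a b {s t} → Balanced s t → Balanced (a ∷ b ∷ s) (b ∷ a ∷ t)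
Balanced-swap a b {t = t} bal with Balanced-∷ a (Balanced-∷ b bal)
... | l , o = l , trans o (ones-swap a b t)

infix 4 _⇆_

data _⇆_ : Bitstring → Bitstring → Set where
  []   : [] ⇆ []
  _∷_  : ∀ b {s t} → s ⇆ t → (b ∷ s) ⇆ (b ∷ t)
  swap : ∀ {a b s t} → a ≢ b → s ⇆ t → (a ∷ b ∷ s) ⇆ (b ∷ a ∷ t)

⇆-sym : ∀ {s t} → s ⇆ t → t ⇆ s
⇆-sym []           = []
⇆-sym (b ∷ d)      = b ∷ ⇆-sym d
⇆-sym (swap a≢b d) = swap (λ b≡a → a≢b (sym b≡a)) (⇆-sym d)

⇆-++ˡ : ∀ xs {s t} → s ⇆ t → (xs ++ s) ⇆ (xs ++ t)
⇆-++ˡ []       d = d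
⇆-++ˡ (x ∷ xs) d = x ∷ ⇆-++ˡ xs d

⇆⇒Balanced : ∀ {s t} → s ⇆ t → Balanced s t
⇆⇒Balanced []                   = refl , refl
⇆⇒Balanced (b ∷ d)              = Balanced-∷ b (⇆⇒Balanced d)
⇆⇒Balanced (swap {a} {b} a≢b d) = Balanced-swap a b (⇆⇒Balanced d)

DefectsCover : Bitstring → Bitstring → Set
DefectsCover S T =
  (i : ℕ) → 1 ≤ i → i ≤ length S → at S i ≢ at T i → Defect S T (i ∸ 1) ⊎ Defect S T i

Defect-∷ : ∀ b {s t i} → Defect s t i → Defect (b ∷ s) (b ∷ t) (suc i)
Defect-∷ b {i = suc i} (_ , i<∣s∣ , bal , d₁ , d₂ , d₃) =
  s≤s z≤n , s≤s i<∣s∣ , Balanced-∷ b bal , d₁ , d₂ , d₃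

Defect-swap : ∀ a b {s t i} → Defect s t i → Defect (a ∷ b ∷ s) (b ∷ a ∷ t) (suc (suc i))
Defect-swap a b {i = suc i} (_ , i<∣s∣ , bal , d₁ , d₂ , d₃) =
  s≤s z≤n , s≤s (s≤s i<∣s∣) , Balanced-swap a b bal , d₁ , d₂ , d₃

swap-Defect : ∀ {a b s t} → a ≢ b → Defect (a ∷ b ∷ s) (b ∷ a ∷ t) 1
swap-Defect a≢b = s≤s z≤n , s≤s (s≤s z≤n) , (refl , refl) , a≢b , a≢b , λ b≡a → a≢b (sym b≡a)

DefectsCover-∷ : ∀ b {s t} → DefectsCover s t → DefectsCover (b ∷ s) (b ∷ t)
DefectsCover-∷ b cover (suc zero)    _ _           b≢b = ⊥-elim (b≢b refl)
DefectsCover-∷ b cover (suc (suc i)) _ (s≤s i<∣s∣) ne =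
  Sum.map (Defect-∷ b) (Defect-∷ b) (cover (suc i) (s≤s z≤n) i<∣s∣ ne)

DefectsCover-swap : ∀ {a b s t} → a ≢ b → DefectsCover s t → DefectsCover (a ∷ b ∷ s) (b ∷ a ∷ t)
DefectsCover-swap {s = s} {t} a≢b cover (suc zero)       _ _ _ = inj₂ (swap-Defect {s = s} {t} a≢b)
DefectsCover-swap {s = s} {t} a≢b cover (suc (suc zero)) _ _ _ = inj₁ (swap-Defect {s = s} {t} a≢b)
DefectsCover-swap {a} {b} a≢b cover (suc (suc (suc i))) _ (s≤s (s≤s i<∣s∣)) ne =
  Sum.map (Defect-swap a b) (Defect-swap a b) (cover (suc i) (s≤s z≤n) i<∣s∣ ne)

⇆⇒DefectsCover : ∀ {s t} → s ⇆ t → DefectsCover s t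
⇆⇒DefectsCover []           (suc _) _ ()
⇆⇒DefectsCover (b ∷ d)      = DefectsCover-∷ b (⇆⇒DefectsCover d)
⇆⇒DefectsCover (swap a≢b d) = DefectsCover-swap a≢b (⇆⇒DefectsCover d)

⇆⇒DifferByDefects : ∀ {s t} → s ⇆ t → DifferByDefects s t
⇆⇒DifferByDefects d = ⇆⇒Balanced d , ⇆⇒DefectsCover d

PrefixLead≤ : ℕ → Bitstring → Bitstring → Set
PrefixLead≤ m S T = ∀ p → ones (take p S) ≤ m + ones (take p T)

lead-tail : ∀ b {m S T} → PrefixLead≤ m (b ∷ S) (b ∷ T) → PrefixLead≤ m S T
lead-tail true  {m} lead p = s≤s⁻¹ (≤-trans (lead (suc p)) (≤-reflexive (+-suc m _)))
lead-tail false     lead p = lead (suc p)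

lead-tail-true-false : ∀ {m S T} → PrefixLead≤ (suc m) (true ∷ S) (false ∷ T) → PrefixLead≤ m S T
lead-tail-true-false lead p = s≤s⁻¹ (lead (suc p))

lead-tail-false-true : ∀ {m S T} → PrefixLead≤ m (false ∷ S) (true ∷ T) → PrefixLead≤ (suc m) S T
lead-tail-false-true {m} lead p = ≤-trans (lead (suc p)) (≤-reflexive (+-suc m _))

-- In w-⇆-pending, S and T are what remains after S has read a 1 where T read a
-- 0: the images w (1 ∷ S) = 0 1 w S and w (0 ∷ T) = 0 0 1 w T agree in their
-- first letter and leave a swap 10 ↔ 01 open.
mutual
  w-⇆ : ∀ {S T} → PrefixLead≤ 1 S T → PrefixLead≤ 1 T S → Balanced S T → w S ⇆ w T
  w-⇆ {[]}    {[]}    _ _ _        = []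
  w-⇆ {[]}    {_ ∷ _} _ _ (() , _)
  w-⇆ {_ ∷ _} {[]}    _ _ (() , _)
  w-⇆ {true ∷ S} {true ∷ T} st ts bal =
    ⇆-++ˡ (wLetter true) (w-⇆ (lead-tail true st) (lead-tail true ts) (Balanced-∷⁻¹ true {S} {T} bal))
  w-⇆ {false ∷ S} {false ∷ T} st ts bal =
    ⇆-++ˡ (wLetter false) (w-⇆ (lead-tail false st) (lead-tail false ts) (Balanced-∷⁻¹ false {S} {T} bal))
  w-⇆ {true ∷ S} {false ∷ T} st ts (l , o) =
    false ∷ w-⇆-pending (lead-tail-true-false st) (lead-tail-false-true ts) (suc-injective l) o
  w-⇆ {false ∷ S} {true ∷ T} st ts (l , o) =
    false ∷ ⇆-sym (w-⇆-pending (lead-tail-true-false ts) (lead-tail-false-true st)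
                                (sym (suc-injective l)) (sym o))

  w-⇆-pending : ∀ {S T} → PrefixLead≤ 0 S T → PrefixLead≤ 2 T S →
                length S ≡ length T → suc (ones S) ≡ ones T →
                true ∷ w S ⇆ false ∷ true ∷ w T
  w-⇆-pending {[]}    {[]}    _ _ _  ()
  w-⇆-pending {[]}    {_ ∷ _} _ _ () _
  w-⇆-pending {_ ∷ _} {[]}    _ _ () _
  w-⇆-pending {true ∷ S} {true ∷ T} st ts l o =
    swap (λ ()) (w-⇆-pending (lead-tail true st) (lead-tail true ts) (suc-injective l) (suc-injective o))
  w-⇆-pending {false ∷ S} {false ∷ T} st ts l o =
    swap (λ ()) (false ∷ w-⇆-pending (lead-tail false st) (lead-tail false ts) (suc-injective l) o)
  w-⇆-pending {true ∷ S} {false ∷ T} st _ _ _ with st 1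
  ... | ()
  w-⇆-pending {false ∷ S} {true ∷ T} st ts l o =
    swap (λ ()) (false ∷ true ∷ w-⇆ (lead-tail-false-true st) (lead-tail-true-false ts)
                                    (suc-injective l , suc-injective o))

ones-take≤ones : ∀ q x → ones (take q x) ≤ ones x
ones-take≤ones zero    x           = z≤n
ones-take≤ones (suc q) []          = z≤n
ones-take≤ones (suc q) (true ∷ x)  = s≤s (ones-take≤ones q x)
ones-take≤ones (suc q) (false ∷ x) = ones-take≤ones q x

ones≤length : ∀ x → ones x ≤ length x
ones≤length []          = z≤n
ones≤length (true ∷ x)  = s≤s (ones≤length x)
ones≤length (false ∷ x) = m≤n⇒m≤1+n (ones≤length x)

ones-w : ∀ x → ones (w x) ≡ length x
ones-w []          = refl
ones-w (true ∷ x)  = cong suc (ones-w x)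
ones-w (false ∷ x) = cong suc (ones-w x)

length-w : ∀ x → length (w x) + ones x ≡ 3 * length x
length-w []          = refl
length-w (true ∷ x)  = begin
  suc (suc (length (w x) + suc (ones x))) ≡⟨ cong (2 +_) (+-suc (length (w x)) (ones x)) ⟩
  3 + (length (w x) + ones x)             ≡⟨ cong (3 +_) (length-w x) ⟩
  3 + 3 * length x                        ≡⟨ sym (*-suc 3 (length x)) ⟩
  3 * suc (length x)                      ∎
  where open ≡-Reasoning
length-w (false ∷ x) = trans (cong (3 +_) (length-w x)) (sym (*-suc 3 (length x)))

Balanced-w : ∀ {S T} → Balanced S T → Balanced (w S) (w T)
Balanced-w {S} {T} (l , o) = ∣wS∣≡∣wT∣ , trans (ones-w S) (trans l (sym (ones-w T)))
  where
  ∣wS∣≡∣wT∣ : length (w S) ≡ length (w T)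
  ∣wS∣≡∣wT∣ = +-cancelʳ-≡ (ones S) (length (w S)) (length (w T)) (begin
    length (w S) + ones S ≡⟨ length-w S ⟩
    3 * length S          ≡⟨ cong (3 *_) l ⟩
    3 * length T          ≡⟨ sym (length-w T) ⟩
    length (w T) + ones T ≡⟨ cong (length (w T) +_) (sym o) ⟩
    length (w T) + ones S ∎)
    where open ≡-Reasoning

length-w-take : ∀ p x → p ≤ length x → length (w (take p x)) + ones (take p x) ≡ 3 * p
length-w-take p x p≤∣x∣ =
  trans (length-w (take p x)) (cong (3 *_) (trans (length-take p x) (m≤n⇒m⊓n≡m p≤∣x∣)))

length-w-take-+ : ∀ a b y → a + b ≤ length y →
                  length (w (take a y)) + 2 * b ≤ length (w (take (a + b) y))
length-w-take-+ zero    zero    y           _ = z≤n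
length-w-take-+ zero    (suc b) []          ()
length-w-take-+ zero    (suc b) (true ∷ y)  (s≤s b≤∣y∣) rewrite *-suc 2 b =
  s≤s (s≤s (length-w-take-+ zero b y b≤∣y∣))
length-w-take-+ zero    (suc b) (false ∷ y) (s≤s b≤∣y∣) rewrite *-suc 2 b =
  s≤s (s≤s (m≤n⇒m≤1+n (length-w-take-+ zero b y b≤∣y∣)))
length-w-take-+ (suc a) b       []          ()
length-w-take-+ (suc a) b       (true ∷ y)  (s≤s a+b≤∣y∣) = s≤s (s≤s (length-w-take-+ a b y a+b≤∣y∣))
length-w-take-+ (suc a) b       (false ∷ y) (s≤s a+b≤∣y∣) = s≤s (s≤s (s≤s (length-w-take-+ a b y a+b≤∣y∣)))

-- Every w b ends in its only 1, so the number of ones in the q-prefix of w x is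
-- the number of letters of x whose image is complete by position q.
length-w-take-ones≤ : ∀ x q → length (w (take (ones (take q (w x))) x)) ≤ q
length-w-take-ones≤ []          zero                = z≤n
length-w-take-ones≤ []          (suc q)             = z≤n
length-w-take-ones≤ (false ∷ x) zero                = z≤n
length-w-take-ones≤ (false ∷ x) (suc zero)          = z≤n
length-w-take-ones≤ (false ∷ x) (suc (suc zero))    = z≤n
length-w-take-ones≤ (false ∷ x) (suc (suc (suc q))) = s≤s (s≤s (s≤s (length-w-take-ones≤ x q)))
length-w-take-ones≤ (true ∷ x)  zero                = z≤n
length-w-take-ones≤ (true ∷ x)  (suc zero)          = z≤n
length-w-take-ones≤ (true ∷ x)  (suc (suc q))       = s≤s (s≤s (length-w-take-ones≤ x q))

<-length-w-take-suc-ones : ∀ x q → ones (take q (w x)) < length x →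
                           q < length (w (take (suc (ones (take q (w x)))) x))
<-length-w-take-suc-ones (false ∷ x) zero                _ = s≤s z≤n
<-length-w-take-suc-ones (false ∷ x) (suc zero)          _ = s≤s (s≤s z≤n)
<-length-w-take-suc-ones (false ∷ x) (suc (suc zero))    _ = s≤s (s≤s (s≤s z≤n))
<-length-w-take-suc-ones (false ∷ x) (suc (suc (suc q))) h =
  s≤s (s≤s (s≤s (<-length-w-take-suc-ones x q (s≤s⁻¹ h))))
<-length-w-take-suc-ones (true ∷ x)  zero                _ = s≤s z≤n
<-length-w-take-suc-ones (true ∷ x)  (suc zero)          _ = s≤s (s≤s z≤n)
<-length-w-take-suc-ones (true ∷ x)  (suc (suc q))       h =
  s≤s (s≤s (<-length-w-take-suc-ones x q (s≤s⁻¹ h)))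

lead≤length : ∀ {m S T} → length S ≤ m → PrefixLead≤ m S T
lead≤length {m} {S} {T} ∣S∣≤m p =
  ≤-trans (ones-take≤ones p S) (≤-trans (ones≤length S) (≤-trans ∣S∣≤m (m≤m+n m (ones (take p T)))))

lead-w : ∀ {m k S T} → m ≤ 2 * k → length S ≡ length T →
         PrefixLead≤ m S T → PrefixLead≤ k (w S) (w T)
lead-w {m} {k} {S} {T} m≤2k ∣S∣≡∣T∣ lead q = ≮⇒≥ impossible
  where
  P  = ones (take q (w S))
  P′ = ones (take q (w T))
  P≤∣S∣ : P ≤ length S
  P≤∣S∣ = ≤-trans (ones-take≤ones q (w S)) (≤-reflexive (ones-w S))
  P≤∣T∣ : P ≤ length T
  P≤∣T∣ = ≤-trans P≤∣S∣ (≤-reflexive ∣S∣≡∣T∣)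
  A = length (w (take P S))
  C = length (w (take P T))
  C≤A+m : C ≤ A + m
  C≤A+m = +-cancelʳ-≤ (ones (take P T)) C (A + m) (begin
    C + ones (take P T)       ≡⟨ length-w-take P T P≤∣T∣ ⟩
    3 * P                     ≡⟨ sym (length-w-take P S P≤∣S∣) ⟩
    A + ones (take P S)       ≤⟨ +-monoʳ-≤ A (lead P) ⟩
    A + (m + ones (take P T)) ≡⟨ sym (+-assoc A m _) ⟩
    A + m + ones (take P T)   ∎)
    where open ≤-Reasoning
  impossible : k + P′ ≮ P
  impossible k+P′<P = <-irrefl refl (begin-strict
    C                                      ≤⟨ C≤A+m ⟩
    A + m                                  ≤⟨ +-monoʳ-≤ A (≤-trans m≤2k (*-monoʳ-≤ 2 k≤r)) ⟩
    A + 2 * r                              <⟨ +-monoˡ-< (2 * r) A<B ⟩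
    length (w (take (suc P′) T)) + 2 * r   ≤⟨ length-w-take-+ (suc P′) r T (≤-trans (≤-reflexive 1+P′+r≡P) P≤∣T∣) ⟩
    length (w (take (suc P′ + r) T))       ≡⟨ cong (λ n → length (w (take n T))) 1+P′+r≡P ⟩
    C                                      ∎)
    where
    open ≤-Reasoning
    k+P′+1≤P : k + suc P′ ≤ P
    k+P′+1≤P = ≤-trans (≤-reflexive (+-suc k P′)) k+P′<P
    r = P ∸ suc P′
    k≤r : k ≤ r
    k≤r = m+n≤o⇒m≤o∸n k k+P′+1≤P
    1+P′+r≡P : suc P′ + r ≡ P
    1+P′+r≡P = m+[n∸m]≡n (m+n≤o⇒n≤o k k+P′+1≤P)
    A<B : A < length (w (take (suc P′) T))
    A<B = ≤-<-trans (length-w-take-ones≤ S q)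
            (<-length-w-take-suc-ones T q (≤-trans (m+n≤o⇒n≤o k k+P′+1≤P) P≤∣T∣))

wⁿ-w : ∀ n S → wⁿ n (w S) ≡ wⁿ (suc n) S
wⁿ-w zero    S = refl
wⁿ-w (suc n) S = cong w (wⁿ-w n S)

differByDefects-wⁿ : ∀ m {S T} → Balanced S T → PrefixLead≤ (suc m) S T → PrefixLead≤ (suc m) T S →
                     DifferByDefects (wⁿ (suc m) S) (wⁿ (suc m) T)
differByDefects-wⁿ zero    bal st ts = ⇆⇒DifferByDefects (w-⇆ st ts bal)
differByDefects-wⁿ (suc m) {S} {T} bal@(l , _) st ts =
  subst₂ DifferByDefects (wⁿ-w (suc m) S) (wⁿ-w (suc m) T)
    (differByDefects-wⁿ m (Balanced-w {S} {T} bal)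
      (lead-w {S = S} {T} 2+m≤2[1+m] l st)
      (lead-w {S = T} {S} 2+m≤2[1+m] (sym l) ts))
  where
  2+m≤2[1+m] : 2 + m ≤ 2 * suc m
  2+m≤2[1+m] = ≤-trans (+-monoʳ-≤ 2 (m≤n*m m 2)) (≤-reflexive (sym (*-suc 2 m)))

lemma9 : (S T : Bitstring) → Balanced S T →
    ∃ λ (n : ℕ) → DifferByDefects (wⁿ n S) (wⁿ n T)
lemma9 S T bal@(l , _) =
  suc (length S) ,
  differByDefects-wⁿ (length S) bal
    (lead≤length (n≤1+n (length S)))
    (lead≤length (≤-trans (≤-reflexive (sym l)) (n≤1+n (length S))))
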